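{- Let $G$ be a finite directed graph and $R\subseteq V(G)$. Let $F_i$ and $F_k$ be maximal faces of $\mathrm{DT}_R(G)$, and let $(x\rightarrow y)\in F_i\setminus F_k$ be an edge which is nice in $\mathrm{DT}_R(G)$. Then there is a maximal face $F_j$ of $\mathrm{DT}_R(G)$ and an $e\in F_k$ such that $F_i\cap F_k\subseteq F_j\cap F_k=F_k\setminus\{e\}$.
   Context: A directed forest in a directed graph $G$ is a set $F$ of edges of $G$ such that at most one edge of $F$ is directed to each vertex and $F$ contains no directed cycle. The roots of $F$ are the vertices of $G$ with no edge of $F$ directed to them. $\mathrm{DT}(G)$ is the simplicial complex with vertex set $E(G)$ whose faces are the edge sets of directed forests of $G$. For $R\subseteq V(G)$, $\mathrm{DT}_R(G)\subseteq\mathrm{DT}(G)$ is the subcomplex generated by the directed forests whose set of roots is exactly $R$; these are its maximal faces. For a subcomplex $\Delta$ of $\mathrm{DT}(G)$, an edge $(x\rightarrow y)$ of $G$ is nice in $\Delta$ if (i) there is an edge $(z\rightarrow y)$ which is a vertex of $\Delta$ with $z\neq x$, and (ii) for every forest $F\in\Delta$ containing no edge directed to $y$, $F\cup\{(x\rightarrow y)\}$ is a directed forest and belongs to $\Delta$. -}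

module Defs where

open import Data.Nat using (ℕ)
open import Data.Fin using (Fin)
open import Data.Fin.Subset using (Subset; _∈_; _∉_; _⊆_; _∪_; ⁅_⁆)
open import Data.Product using (Σ; ∃; _×_; _,_)
open import Relation.Binary.PropositionalEquality using (_≡_)
open import Relation.Nullary using (¬_)

-- Loops are allowed; parallel edges are
-- not (an edge is determined by its endpoints, as in the notation (x→y)).
record Digraph : Set where
  field
    n   : ℕ
    m   : ℕ
    src : Fin m → Fin n
    tgt : Fin m → Fin n
    simple : ∀ e e' → src e ≡ src e' → tgt e ≡ tgt e' → e ≡ e'

open Digraph public

V : Digraph → Set
V G = Fin (n G)

E : Digraph → Set
E G = Fin (m G)

EdgeSet : Digraph → Set
EdgeSet G = Subset (m G)

module _ (G : Digraph) where

  data Walk (F : EdgeSet G) : V G → V G → Set where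
    edge : ∀ e → e ∈ F → Walk F (src G e) (tgt G e)
    _∷w_ : ∀ {w} e → e ∈ F → Walk F (tgt G e) w → Walk F (src G e) w

  HasDirectedCycle : EdgeSet G → Set
  HasDirectedCycle F = ∃ λ v → Walk F v v

  IsDirectedForest : EdgeSet G → Set
  IsDirectedForest F =
    (∀ e e' → e ∈ F → e' ∈ F → tgt G e ≡ tgt G e' → e ≡ e')
    × ¬ HasDirectedCycle F

  IsRoot : EdgeSet G → V G → Set
  IsRoot F v = ¬ (∃ λ e → e ∈ F × tgt G e ≡ v)

  HasRoots : EdgeSet G → Subset (n G) → Set
  HasRoots F R = ∀ v → (v ∈ R → IsRoot F v) × (IsRoot F v → v ∈ R)

  FaceDT_R : Subset (n G) → EdgeSet G → Set
  FaceDT_R R F = ∃ λ T → IsDirectedForest T × HasRoots T R × F ⊆ T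

  MaxFaceDT_R : Subset (n G) → EdgeSet G → Set
  MaxFaceDT_R R F = FaceDT_R R F × (∀ F' → FaceDT_R R F' → F ⊆ F' → F' ⊆ F)

  NiceDT_R : Subset (n G) → E G → Set
  NiceDT_R R e =
    (∃ λ e' → tgt G e' ≡ tgt G e × ¬ (src G e' ≡ src G e) × FaceDT_R R ⁅ e' ⁆)
    × (∀ F → FaceDT_R R F → (∀ f → f ∈ F → ¬ (tgt G f ≡ tgt G e)) →
         IsDirectedForest (F ∪ ⁅ e ⁆) × FaceDT_R R (F ∪ ⁅ e ⁆))

{-# OPTIONS --safe #-}
-- Maximal faces of DT_R(G) are exactly the faces with an incoming edge at every
-- vertex outside R.  Since xy lies in a face, its head y is not a root, so Fk
-- has a unique edge e into y.  Swapping e for xy keeps a face by niceness and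
-- still reaches every non-root, so Fj = (Fk - e) ∪ {xy} is maximal.  As Fi has
-- only one edge into y, namely xy ∉ Fk, the common part Fi ∩ Fk avoids e.
module Submission where

open import Defs
open import Data.Nat using (ℕ)
open import Data.Fin using (Fin)
open import Data.Fin.Properties using (any?; _≟_)
open import Data.Fin.Subset using (Subset; _∈_; _∉_; _⊆_; _∩_; _∪_; _─_; _-_; ⁅_⁆; outside)
open import Data.Fin.Subset.Properties
  using (_∈?_; x∈⁅x⁆; x∈⁅y⁆⇒x≡y; x∉⁅y⁆⇒x≢y; ⊆-antisym; p─q⊆p; x∈p∧x≢y⇒x∈p-y;
         x∈p∩q⁺; x∈p∩q⁻; x∈p∪q⁺; x∈p∪q⁻)
open import Data.Product using (∃; _×_; _,_; proj₁; proj₂)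
open import Data.Sum using (inj₁; inj₂)
open import Data.Vec using (_∷_; here; there)
open import Relation.Binary.PropositionalEquality using (_≡_; _≢_; refl; sym; trans; subst)
open import Relation.Nullary using (¬_; yes; no; contradiction)
open import Relation.Nullary.Decidable using (decidable-stable; _×-dec_)

private
  variable
    k : ℕ
    x y : Fin k
    p q : Subset k

x∈p─q⇒x∉q : x ∈ p ─ q → x ∉ q
x∈p─q⇒x∉q {p = _ ∷ _} {q = outside ∷ _} here      ()
x∈p─q⇒x∉q {p = _ ∷ _} {q = _ ∷ _}       (there m) (there m') = x∈p─q⇒x∉q m m'

x∈p-y⇒x≢y : x ∈ p - y → x ≢ y
x∈p-y⇒x≢y x∈p-y = x∉⁅y⁆⇒x≢y (x∈p─q⇒x∉q x∈p-y)

x∈p-y⇒x∈p : x ∈ p - y → x ∈ p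
x∈p-y⇒x∈p {p = p} {y = y} = p─q⊆p p ⁅ y ⁆

x∉p⇒p∩q⊆q-x : x ∉ p → p ∩ q ⊆ q - x
x∉p⇒p∩q⊆q-x {p = p} {q = q} x∉p z∈p∩q =
  let (z∈p , z∈q) = x∈p∩q⁻ p q z∈p∩q
  in x∈p∧x≢y⇒x∈p-y z∈q (λ { refl → x∉p z∈p })

x∉p⇒p-y∪⁅x⁆∩p≡p-y : x ∉ p → ((p - y) ∪ ⁅ x ⁆) ∩ p ≡ p - y
x∉p⇒p-y∪⁅x⁆∩p≡p-y {x = x} {p = p} {y = y} x∉p = ⊆-antisym ⊆p-y p-y⊆
  where
  ⊆p-y : ((p - y) ∪ ⁅ x ⁆) ∩ p ⊆ p - y
  ⊆p-y z∈ with x∈p∩q⁻ ((p - y) ∪ ⁅ x ⁆) p z∈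
  ... | z∈p-y∪x , z∈p with x∈p∪q⁻ (p - y) ⁅ x ⁆ z∈p-y∪x
  ...   | inj₁ z∈p-y = z∈p-y
  ...   | inj₂ z∈⁅x⁆ = contradiction (subst (_∈ p) (x∈⁅y⁆⇒x≡y x z∈⁅x⁆) z∈p) x∉p

  p-y⊆ : p - y ⊆ ((p - y) ∪ ⁅ x ⁆) ∩ p
  p-y⊆ z∈p-y = x∈p∩q⁺ (x∈p∪q⁺ (inj₁ z∈p-y) , x∈p-y⇒x∈p z∈p-y)

module _ (G : Digraph) where

  ¬root⇒∃incoming : ∀ {T v} → ¬ IsRoot G T v → ∃ λ e → e ∈ T × tgt G e ≡ v
  ¬root⇒∃incoming {T} {v} =
    decidable-stable (any? λ e → (e ∈? T) ×-dec (tgt G e ≟ v))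

module _ (G : Digraph) (R : Subset (n G)) where

  CoversNonRoots : EdgeSet G → Set
  CoversNonRoots F = ∀ v → v ∉ R → ∃ λ e → e ∈ F × tgt G e ≡ v

  private
    variable
      F F' : EdgeSet G
      e e' : E G

  face-⊆ : F' ⊆ F → FaceDT_R G R F → FaceDT_R G R F'
  face-⊆ F'⊆F (T , forestT , rootsT , F⊆T) =
    T , forestT , rootsT , λ z∈F' → F⊆T (F'⊆F z∈F')

  face-tgt-injective : FaceDT_R G R F → e ∈ F → e' ∈ F → tgt G e ≡ tgt G e' → e ≡ e'
  face-tgt-injective (T , (injT , _) , _ , F⊆T) e∈F e'∈F =
    injT _ _ (F⊆T e∈F) (F⊆T e'∈F)

  face-tgt∉R : FaceDT_R G R F → e ∈ F → tgt G e ∉ R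
  face-tgt∉R (T , _ , rootsT , F⊆T) e∈F tgt∈R =
    proj₁ (rootsT _) tgt∈R (_ , F⊆T e∈F , refl)

  maxFace⇒covers : MaxFaceDT_R G R F → CoversNonRoots F
  maxFace⇒covers ((T , forestT , rootsT , F⊆T) , maximal) v v∉R =
    let (e , e∈T , e↦v) = ¬root⇒∃incoming G (λ root → v∉R (proj₂ (rootsT v) root))
    in e , maximal T (T , forestT , rootsT , λ z → z) F⊆T e∈T , e↦v

  covers⇒maxFace : FaceDT_R G R F → CoversNonRoots F → MaxFaceDT_R G R F
  covers⇒maxFace {F} faceF covers = faceF , maximal
    where
    maximal : ∀ F' → FaceDT_R G R F' → F ⊆ F' → F' ⊆ F
    maximal F' faceF' F⊆F' {t} t∈F' =
      let (f , f∈F , f↦t) = covers (tgt G t) (face-tgt∉R faceF' t∈F')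
      in subst (_∈ F) (face-tgt-injective faceF' (F⊆F' f∈F) t∈F' f↦t) f∈F

  exchange-maxFace : ∀ {xy} → MaxFaceDT_R G R F → e ∈ F → NiceDT_R G R xy →
                     tgt G e ≡ tgt G xy → MaxFaceDT_R G R ((F - e) ∪ ⁅ xy ⁆)
  exchange-maxFace {F} {e} {xy} maxF e∈F (_ , extend) e↦y =
    covers⇒maxFace (proj₂ (extend (F - e) (face-⊆ x∈p-y⇒x∈p faceF) noEdgeInto)) covers
    where
    faceF : FaceDT_R G R F
    faceF = proj₁ maxF

    noEdgeInto : ∀ f → f ∈ F - e → ¬ (tgt G f ≡ tgt G xy)
    noEdgeInto f f∈F-e f↦y = x∈p-y⇒x≢y f∈F-e
      (face-tgt-injective faceF (x∈p-y⇒x∈p f∈F-e) e∈F (trans f↦y (sym e↦y)))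

    covers : CoversNonRoots ((F - e) ∪ ⁅ xy ⁆)
    covers v v∉R with maxFace⇒covers maxF v v∉R
    ... | f , f∈F , f↦v with f ≟ e
    ...   | yes refl = xy , x∈p∪q⁺ (inj₂ (x∈⁅x⁆ xy)) , trans (sym e↦y) f↦v
    ...   | no f≢e = f , x∈p∪q⁺ (inj₁ (x∈p∧x≢y⇒x∈p-y f∈F f≢e)) , f↦v

lemma2p8 : (G : Digraph) (R : Subset (n G)) (Fi Fk : EdgeSet G) (xy : E G) →
    MaxFaceDT_R G R Fi → MaxFaceDT_R G R Fk →
    xy ∈ Fi → xy ∉ Fk → NiceDT_R G R xy →
    ∃ λ Fj → ∃ λ e → MaxFaceDT_R G R Fj × e ∈ Fk ×
      (Fi ∩ Fk ⊆ Fj ∩ Fk) × (Fj ∩ Fk ≡ Fk - e)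
lemma2p8 G R Fi Fk xy maxFi maxFk xy∈Fi xy∉Fk nice
  with maxFace⇒covers G R maxFk (tgt G xy) (face-tgt∉R G R (proj₁ maxFi) xy∈Fi)
... | e , e∈Fk , e↦y =
  Fj , e , exchange-maxFace G R maxFk e∈Fk nice e↦y , e∈Fk ,
  subst (Fi ∩ Fk ⊆_) (sym Fj∩Fk≡Fk-e) (x∉p⇒p∩q⊆q-x e∉Fi) , Fj∩Fk≡Fk-e
  where
  Fj : EdgeSet G
  Fj = (Fk - e) ∪ ⁅ xy ⁆

  Fj∩Fk≡Fk-e : Fj ∩ Fk ≡ Fk - e
  Fj∩Fk≡Fk-e = x∉p⇒p-y∪⁅x⁆∩p≡p-y xy∉Fk

  e∉Fi : e ∉ Fi
  e∉Fi e∈Fi =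
    xy∉Fk (subst (_∈ Fk) (face-tgt-injective G R (proj₁ maxFi) e∈Fi xy∈Fi e↦y) e∈Fk)
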